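{- Let $k,\ell\ge1$. A function $f:\mathbb{N}^k\to\mathbb{N}^\ell$ can be computed by a finite abelian network whose nodes are splitters and adders if and only if $f(\mathbf{x})=L\mathbf{x}$ for some $\ell\times k$ matrix $L$ with nonnegative integer entries.
   Context: $\mathbb{N}=\{0,1,2,\dots\}$. An abelian network is a finite directed multigraph with dangling input edges (no tail) and output/trash edges (no head), each node carrying a finite processor (here: splitters and adders) whose inputs/outputs are its incoming/outgoing edges. It runs by repeatedly feeding one letter from any non-output, non-trash edge carrying a letter into the node at its head, which places its emitted letters on its outgoing edges; it halts when all letters lie on output or trash edges (this is independent of the order of choices). The network computes a function $\mathbb{N}^k\to\mathbb{N}^\ell$ ($k$ input edges, $\ell$ output edges) only if it halts on all inputs, the function giving the numbers of letters on output edges at halting. A splitter has one input and two outputs and emits one letter on each output per letter received; an adder has two inputs and one output and emits one letter per letter received on either input. -}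

module Defs where

open import Data.Nat using (ℕ; zero; suc; _+_; _*_; _∸_; _≤_)
open import Data.Fin using (Fin; _≟_)
open import Data.Sum using (_⊎_; inj₁; inj₂)
open import Data.Product using (Σ; ∃; _×_; _,_; proj₁; proj₂)
import Data.Sum.Properties as SumP
import Data.Product.Properties as ProdP
open import Data.Vec using (sum; tabulate)
open import Relation.Nullary using (yes; no)
open import Relation.Binary.PropositionalEquality using (_≡_; refl)
open import Relation.Binary.Definitions using (DecidableEquality)
open import Relation.Binary.Construct.Closure.ReflexiveTransitive using (Star)

data Kind : Set where
  splitter adder : Kind

indeg : Kind → ℕ
indeg splitter = 1
indeg adder    = 2

outdeg : Kind → ℕ
outdeg splitter = 2
outdeg adder    = 1

-- The processors: number of letters emitted on output port q when one letter
-- is received on input port p.  A splitter emits one letter on each of its two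
-- outputs; an adder emits one letter on its output, for either input.
emit : (κ : Kind) → Fin (indeg κ) → Fin (outdeg κ) → ℕ
emit splitter p q = 1
emit adder    p q = 1

InPort : {n : ℕ} → (Fin n → Kind) → Set
InPort {n} kind = Σ (Fin n) λ v → Fin (indeg (kind v))

OutPort : {n : ℕ} → (Fin n → Kind) → Set
OutPort {n} kind = Σ (Fin n) λ v → Fin (outdeg (kind v))

-- Edges are identified by their tail: either the i-th input edge (no tail)
-- or the edge leaving a given output port of a node.
Edge : (k : ℕ) {n : ℕ} → (Fin n → Kind) → Set
Edge k kind = Fin k ⊎ OutPort kind

data Head {n : ℕ} (ℓ : ℕ) (kind : Fin n → Kind) : Set where
  node   : InPort kind → Head ℓ kind
  output : Fin ℓ → Head ℓ kind
  trash  : Head ℓ kind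

record Network (k ℓ : ℕ) : Set where
  field
    n     : ℕ
    kind  : Fin n → Kind
    head  : Edge k kind → Head ℓ kind
    -- input edges have a head (an edge has at least one endpoint)
    input-head : ∀ i → ∃ λ p → head (inj₁ i) ≡ node p
    inEdge        : InPort kind → Edge k kind
    inEdge-head   : ∀ p → head (inEdge p) ≡ node p
    inEdge-unique : ∀ p e → head e ≡ node p → e ≡ inEdge p
    outEdge        : Fin ℓ → Edge k kind
    outEdge-head   : ∀ j → head (outEdge j) ≡ output j
    outEdge-unique : ∀ j e → head e ≡ output j → e ≡ outEdge j

module _ {k ℓ : ℕ} (N : Network k ℓ) where
  open Network N

  Config : Set
  Config = Edge k kind → ℕ

  _≟E_ : DecidableEquality (Edge k kind)
  _≟E_ = SumP.≡-dec _≟_ (ProdP.≡-dec _≟_ _≟_)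

  removed : Edge k kind → Edge k kind → ℕ
  removed e e' with e' ≟E e
  ... | yes _ = 1
  ... | no  _ = 0

  emitted : (v : Fin n) → Fin (indeg (kind v)) → Edge k kind → ℕ
  emitted v p (inj₁ _) = 0
  emitted v p (inj₂ (w , q)) with w ≟ v
  ... | yes refl = emit (kind v) p q
  ... | no  _    = 0

  fire : Config → Edge k kind → InPort kind → Config
  fire c e (v , p) e' = (c e' ∸ removed e e') + emitted v p e'

  data Step : Config → Config → Set where
    step : ∀ c e p → head e ≡ node p → 1 ≤ c e → Step c (fire c e p)

  Reachable : Config → Config → Set
  Reachable = Star Step

  initial : (Fin k → ℕ) → Config
  initial x (inj₁ i) = x i
  initial x (inj₂ _) = 0

  Halted : Config → Set
  Halted c = ∀ e p → head e ≡ node p → c e ≡ 0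

  outputs : Config → Fin ℓ → ℕ
  outputs c j = c (outEdge j)

  Computes : ((Fin k → ℕ) → (Fin ℓ → ℕ)) → Set
  Computes f = ∀ x →
      (∃ λ c → Reachable (initial x) c × Halted c × (∀ j → outputs c j ≡ f x j))
    × (∀ c → Reachable (initial x) c → Halted c → ∀ j → outputs c j ≡ f x j)

SAComputable : {k ℓ : ℕ} → ((Fin k → ℕ) → (Fin ℓ → ℕ)) → Set
SAComputable {k} {ℓ} f = Σ (Network k ℓ) λ N → Computes N f

IsLinear : {k ℓ : ℕ} → ((Fin k → ℕ) → (Fin ℓ → ℕ)) → Set
IsLinear {k} {ℓ} f = Σ (Fin ℓ → Fin k → ℕ) λ L →
  ∀ x j → f x j ≡ sum (tabulate λ i → L j i * x i)

-- Soundness (computable ⇒ linear) rests on the abelian property of networks: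
-- an execution stays executable after extra letters are added, and carries
-- them along unchanged (reachable-⊕).  Running x to completion and then y on
-- top gives f (x + y) = f x + f y; with f 0 = 0, an additive map on ℕᵏ is
-- determined by its values on unit vectors (additive⇒linear).
--
-- Completeness (linear ⇒ computable) goes through certificates: a weight on
-- nodes per output that is balanced at every live node, a depth that strictly
-- drops along edges, and dead nodes fed only by dead nodes.  The weighted
-- letter count is then invariant and the depth count a decreasing potential,
-- so a certified network halts on every input with output the certified map
-- (Certified.computes).

module Submission where

open import Defs
open import Data.Bool using (Bool; true; false)
open import Data.Empty using (⊥-elim)
open import Data.Fin using (Fin; zero; suc; _≟_; toℕ; inject₁; fromℕ)
open import Data.Fin.Properties using (toℕ-inject₁; toℕ-fromℕ; toℕ<n; +↔⊎; *↔×)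
open import Data.List using (List; []; _∷_; _++_; length; lookup; drop; concat; tabulate; replicate)
open import Data.List.Properties using (drop-all)
open import Data.Nat using (ℕ; zero; suc; _+_; _*_; _∸_; _≤_; _<_; z≤n; s≤s)
open import Data.Nat.Properties hiding (_≟_)
open import Data.Product using (Σ; ∃; _×_; _,_; proj₁; proj₂)
open import Data.Sum using (_⊎_; inj₁; inj₂)
open import Data.Sum.Function.Propositional using (_⊎-↔_)
import Data.Vec as Vec
open import Function.Base using (_∘′_)
open import Function.Bundles using (_↔_; Inverse; mk↔ₛ′)
open import Function.Properties.Inverse using (↔-refl; ↔-sym; ↔-trans)
open import Relation.Nullary using (yes; no)
open import Relation.Binary.PropositionalEquality
open import Relation.Binary.Construct.Closure.ReflexiveTransitive using (ε; _◅_; _◅◅_)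
open import Algebra.Properties.Semiring.Sum +-*-semiring
  using (sum; sum-syntax; sum-cong-≗; ∑-distrib-+; sum-replicate-zero)
open import Algebra.Properties.CommutativeSemigroup +-commutativeSemigroup
  using (interchange; xy∙z≈xz∙y)

∑-zero : ∀ {m} {g : Fin m → ℕ} → (∀ i → g i ≡ 0) → sum g ≡ 0
∑-zero {zero}  g≡0 = refl
∑-zero {suc m} g≡0 = cong₂ _+_ (g≡0 zero) (∑-zero (λ i → g≡0 (suc i)))

∑-select : ∀ {m} {g : Fin m → ℕ} (i₀ : Fin m) → (∀ i → i ≢ i₀ → g i ≡ 0) → sum g ≡ g i₀
∑-select {suc m} {g} zero     g≡0 =
  trans (cong (g zero +_) (∑-zero (λ i → g≡0 (suc i) λ ()))) (+-identityʳ (g zero))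
∑-select {suc m} {g} (suc i₀) g≡0 =
  cong₂ _+_ (g≡0 zero λ ()) (∑-select i₀ (λ i i≢i₀ → g≡0 (suc i) λ { refl → i≢i₀ refl }))

∑≡sum-tabulate : ∀ {m} (g : Fin m → ℕ) → sum g ≡ Vec.sum (Vec.tabulate g)
∑≡sum-tabulate {zero}  g = refl
∑≡sum-tabulate {suc m} g = cong (g zero +_) (∑≡sum-tabulate (λ i → g (suc i)))

δ : ∀ {m} → Fin m → Fin m → ℕ
δ a b with a ≟ b
... | yes _ = 1
... | no  _ = 0

δ-diag : ∀ {m} (a : Fin m) → δ a a ≡ 1
δ-diag a with a ≟ a
... | yes _   = refl
... | no  a≢a = ⊥-elim (a≢a refl)

δ-off : ∀ {m} {a b : Fin m} → a ≢ b → δ a b ≡ 0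
δ-off {a = a} {b} a≢b with a ≟ b
... | yes a≡b = ⊥-elim (a≢b a≡b)
... | no  _   = refl

∑-δ : ∀ {m} (x : Fin m → ℕ) t → ∑[ i < m ] (x i * δ i t) ≡ x t
∑-δ x t = trans (∑-select t (λ i i≢t → trans (cong (x i *_) (δ-off i≢t)) (*-zeroʳ (x i))))
                (trans (cong (x t *_) (δ-diag t)) (*-identityʳ (x t)))

δ-sym : ∀ {m} (a b : Fin m) → δ a b ≡ δ b a
δ-sym a b with a ≟ b | b ≟ a
... | yes _   | yes _   = refl
... | no  _   | no  _   = refl
... | yes a≡b | no  b≢a = ⊥-elim (b≢a (sym a≡b))
... | no  a≢b | yes b≡a = ⊥-elim (a≢b (sym b≡a))

module EdgeSums {k n : ℕ} (kind : Fin n → Kind) where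

  ∑E : (Edge k kind → ℕ) → ℕ
  ∑E g = ∑[ i < k ] g (inj₁ i) + ∑[ v < n ] ∑[ q < outdeg (kind v) ] g (inj₂ (v , q))

  ∑E-cong : ∀ {g h : Edge k kind → ℕ} → g ≗ h → ∑E g ≡ ∑E h
  ∑E-cong g≗h = cong₂ _+_ (sum-cong-≗ (λ i → g≗h (inj₁ i)))
                          (sum-cong-≗ (λ v → sum-cong-≗ (λ q → g≗h (inj₂ (v , q)))))

  ∑E-distrib-+ : ∀ (g h : Edge k kind → ℕ) → ∑E (λ e → g e + h e) ≡ ∑E g + ∑E h
  ∑E-distrib-+ g h = begin
    ∑E (λ e → g e + h e)
      ≡⟨ cong₂ _+_ (∑-distrib-+ (λ i → g (inj₁ i)) (λ i → h (inj₁ i)))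
                   (trans (sum-cong-≗ (λ v → ∑-distrib-+ (λ q → g (inj₂ (v , q))) (λ q → h (inj₂ (v , q)))))
                          (∑-distrib-+ (λ v → ∑[ q < _ ] g (inj₂ (v , q))) (λ v → ∑[ q < _ ] h (inj₂ (v , q))))) ⟩
    (Gᵢ + Hᵢ) + (Gₒ + Hₒ)
      ≡⟨ interchange Gᵢ Hᵢ Gₒ Hₒ ⟩
    ∑E g + ∑E h ∎
    where
    open ≡-Reasoning
    Gᵢ Hᵢ Gₒ Hₒ : ℕ
    Gᵢ = ∑[ i < k ] g (inj₁ i)
    Hᵢ = ∑[ i < k ] h (inj₁ i)
    Gₒ = ∑[ v < n ] ∑[ q < outdeg (kind v) ] g (inj₂ (v , q))
    Hₒ = ∑[ v < n ] ∑[ q < outdeg (kind v) ] h (inj₂ (v , q))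

  ∑E-select : ∀ {g : Edge k kind → ℕ} e₀ → (∀ e → e ≢ e₀ → g e ≡ 0) → ∑E g ≡ g e₀
  ∑E-select (inj₁ i₀) g≡0 = trans
    (cong₂ _+_ (∑-select i₀ (λ i i≢i₀ → g≡0 (inj₁ i) λ { refl → i≢i₀ refl }))
               (∑-zero (λ v → ∑-zero (λ q → g≡0 (inj₂ (v , q)) λ ()))))
    (+-identityʳ _)
  ∑E-select (inj₂ (v₀ , q₀)) g≡0 = trans
    (cong₂ _+_ (∑-zero (λ i → g≡0 (inj₁ i) λ ()))
               (∑-select v₀ (λ v v≢v₀ → ∑-zero (λ q → g≡0 (inj₂ (v , q)) λ { refl → v≢v₀ refl }))))
    (∑-select q₀ (λ q q≢q₀ → g≡0 (inj₂ (v₀ , q)) λ { refl → q≢q₀ refl }))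

emit≡1 : ∀ κ p q → emit κ p q ≡ 1
emit≡1 splitter p q = refl
emit≡1 adder    p q = refl

module Firing {k ℓ : ℕ} (N : Network k ℓ) where
  open Network N
  open EdgeSums {k} kind public

  ∑out : (Edge k kind → ℕ) → Fin n → ℕ
  ∑out w v = ∑[ q < outdeg (kind v) ] w (inj₂ (v , q))

  ⟪_∣_⟫ : Config N → (Edge k kind → ℕ) → ℕ
  ⟪ c ∣ w ⟫ = ∑E (λ e → c e * w e)

  fire-balance : ∀ c e v p → 1 ≤ c e → ∀ e' →
    fire N c e (v , p) e' + removed N e e' ≡ c e' + emitted N v p e'
  fire-balance c e v p 1≤ce e' with _≟E_ N e' e
  ... | yes refl = trans (+-comm (c e ∸ 1 + emitted N v p e) 1)
                         (cong (_+ emitted N v p e) (m+[n∸m]≡n 1≤ce))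
  ... | no  _    = +-identityʳ _

  ⟪removed∣⟫ : ∀ e w → ⟪ removed N e ∣ w ⟫ ≡ w e
  ⟪removed∣⟫ e w = trans (∑E-select e off) on
    where
    off : ∀ e' → e' ≢ e → removed N e e' * w e' ≡ 0
    off e' e'≢e with _≟E_ N e' e
    ... | yes e'≡e = ⊥-elim (e'≢e e'≡e)
    ... | no  _    = refl
    on : removed N e e * w e ≡ w e
    on with _≟E_ N e e
    ... | yes _   = +-identityʳ (w e)
    ... | no  e≢e = ⊥-elim (e≢e refl)

  ⟪emitted∣⟫ : ∀ v p w → ⟪ emitted N v p ∣ w ⟫ ≡ ∑out w v
  ⟪emitted∣⟫ v p w =
    trans (cong₂ _+_ (∑-zero {g = λ i → emitted N v p (inj₁ i) * w (inj₁ i)} (λ i → refl))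
                     (∑-select v (λ u u≢v → ∑-zero (off u u≢v))))
          (sum-cong-≗ on)
    where
    off : ∀ u → u ≢ v → ∀ q → emitted N v p (inj₂ (u , q)) * w (inj₂ (u , q)) ≡ 0
    off u u≢v q with u ≟ v
    ... | yes u≡v = ⊥-elim (u≢v u≡v)
    ... | no  _   = refl
    on : ∀ q → emitted N v p (inj₂ (v , q)) * w (inj₂ (v , q)) ≡ w (inj₂ (v , q))
    on q with v ≟ v
    ... | yes refl = trans (cong (_* w (inj₂ (v , q))) (emit≡1 (kind v) p q)) (+-identityʳ _)
    ... | no  v≢v  = ⊥-elim (v≢v refl)

  ⟪fire∣⟫ : ∀ c e v p → 1 ≤ c e → ∀ w →
    ⟪ fire N c e (v , p) ∣ w ⟫ + w e ≡ ⟪ c ∣ w ⟫ + ∑out w v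
  ⟪fire∣⟫ c e v p 1≤ce w = begin
    ⟪ c' ∣ w ⟫ + w e                                        ≡⟨ cong (⟪ c' ∣ w ⟫ +_) (⟪removed∣⟫ e w) ⟨
    ⟪ c' ∣ w ⟫ + ⟪ removed N e ∣ w ⟫                          ≡⟨ ∑E-distrib-+ (λ e' → c' e' * w e') (λ e' → removed N e e' * w e') ⟨
    ∑E (λ e' → c' e' * w e' + removed N e e' * w e')          ≡⟨ ∑E-cong balance ⟩
    ∑E (λ e' → c e' * w e' + emitted N v p e' * w e')         ≡⟨ ∑E-distrib-+ (λ e' → c e' * w e') (λ e' → emitted N v p e' * w e') ⟩
    ⟪ c ∣ w ⟫ + ⟪ emitted N v p ∣ w ⟫                         ≡⟨ cong (⟪ c ∣ w ⟫ +_) (⟪emitted∣⟫ v p w) ⟩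
    ⟪ c ∣ w ⟫ + ∑out w v                                    ∎
    where
    open ≡-Reasoning
    c' : Config N
    c' = fire N c e (v , p)
    balance : ∀ e' → c' e' * w e' + removed N e e' * w e' ≡ c e' * w e' + emitted N v p e' * w e'
    balance e' = begin
      c' e' * w e' + removed N e e' * w e'   ≡⟨ *-distribʳ-+ (w e') (c' e') _ ⟨
      (c' e' + removed N e e') * w e'        ≡⟨ cong (_* w e') (fire-balance c e v p 1≤ce e') ⟩
      (c e' + emitted N v p e') * w e'       ≡⟨ *-distribʳ-+ (w e') (c e') _ ⟩
      c e' * w e' + emitted N v p e' * w e'  ∎

module _ {k : ℕ} (g : (Fin k → ℕ) → ℕ)
         (g-cong : ∀ {x y} → x ≗ y → g x ≡ g y)
         (g-0 : g (λ _ → 0) ≡ 0)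
         (g-+ : ∀ x y → g (λ i → x i + y i) ≡ g x + g y) where

  additive-scale : ∀ a x → g (λ i → a * x i) ≡ a * g x
  additive-scale zero    x = g-0
  additive-scale (suc a) x = trans (g-+ x (λ i → a * x i)) (cong (g x +_) (additive-scale a x))

  additive-∑ : ∀ m (h : Fin m → Fin k → ℕ) → g (λ t → ∑[ i < m ] h i t) ≡ ∑[ i < m ] g (h i)
  additive-∑ zero    h = g-0
  additive-∑ (suc m) h = trans (g-+ (h zero) (λ t → ∑[ i < m ] h (suc i) t))
                               (cong (g (h zero) +_) (additive-∑ m (λ i → h (suc i))))

  additive⇒linear : ∀ x → g x ≡ ∑[ i < k ] (x i * g (δ i))
  additive⇒linear x = begin
    g x                                ≡⟨ g-cong (λ t → sym (∑-δ x t)) ⟩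
    g (λ t → ∑[ i < k ] (x i * δ i t))  ≡⟨ additive-∑ k (λ i t → x i * δ i t) ⟩
    ∑[ i < k ] g (λ t → x i * δ i t)    ≡⟨ sum-cong-≗ (λ i → additive-scale (x i) (δ i)) ⟩
    ∑[ i < k ] (x i * g (δ i))          ∎
    where open ≡-Reasoning

module _ {k ℓ : ℕ} (N : Network k ℓ) where
  open Network N

  _⊕_ : Config N → Config N → Config N
  (c ⊕ c₀) e = c e + c₀ e

  reachable-resp-≗ : ∀ {c d} c' → c ≗ c' → Reachable N c d →
                     ∃ λ d' → Reachable N c' d' × d ≗ d'
  reachable-resp-≗ c' c≗c' ε = c' , ε , c≗c'
  reachable-resp-≗ c' c≗c' (step c e (v , p) he 1≤ce ◅ run)
    with reachable-resp-≗ (fire N c' e (v , p))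
           (λ e' → cong (λ m → m ∸ removed N e e' + emitted N v p e') (c≗c' e')) run
  ... | d' , run' , d≗d' = d' , step c' e (v , p) he (subst (1 ≤_) (c≗c' e) 1≤ce) ◅ run' , d≗d'

  fire-⊕ : ∀ c c₀ e v p → 1 ≤ c e → fire N (c ⊕ c₀) e (v , p) ≗ fire N c e (v , p) ⊕ c₀
  fire-⊕ c c₀ e v p 1≤ce e' with _≟E_ N e' e
  ... | yes refl = trans (cong (_+ emitted N v p e) (+-∸-comm (c₀ e) 1≤ce))
                         (xy∙z≈xz∙y (c e ∸ 1) (c₀ e) _)
  ... | no  _    = xy∙z≈xz∙y (c e') (c₀ e') _

  reachable-⊕ : ∀ {c d} c₀ → Reachable N c d → ∃ λ d' → Reachable N (c ⊕ c₀) d' × d' ≗ d ⊕ c₀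
  reachable-⊕ {c} c₀ ε = c ⊕ c₀ , ε , λ e → refl
  reachable-⊕ c₀ (step c e (v , p) he 1≤ce ◅ run) with reachable-⊕ c₀ run
  ... | d₁ , run₁ , d₁≗ with reachable-resp-≗ (fire N (c ⊕ c₀) e (v , p))
                               (λ e' → sym (fire-⊕ c c₀ e v p 1≤ce e')) run₁
  ... | d₂ , run₂ , d₁≗d₂ =
    d₂ , step (c ⊕ c₀) e (v , p) he (≤-trans 1≤ce (m≤m+n (c e) (c₀ e))) ◅ run₂ ,
    λ e' → trans (sym (d₁≗d₂ e')) (d₁≗ e')

  module Computed (f : (Fin k → ℕ) → (Fin ℓ → ℕ)) (computes : Computes N f) where

    result : ∀ x → ∃ λ c → Reachable N (initial N x) c × Halted N c × (∀ j → outputs N c j ≡ f x j)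
    result x = proj₁ (computes x)

    correct : ∀ x c → Reachable N (initial N x) c → Halted N c → ∀ j → outputs N c j ≡ f x j
    correct x = proj₂ (computes x)

    initial-⊕ : ∀ x y → initial N x ⊕ initial N y ≗ initial N (λ i → x i + y i)
    initial-⊕ x y (inj₁ i) = refl
    initial-⊕ x y (inj₂ _) = refl

    initial-cong : ∀ {x y} → x ≗ y → initial N x ≗ initial N y
    initial-cong x≗y (inj₁ i) = x≗y i
    initial-cong x≗y (inj₂ _) = refl

    f-cong : ∀ {x y} → x ≗ y → ∀ j → f x j ≡ f y j
    f-cong {x} {y} x≗y j with result x
    ... | c , run , halted , out with reachable-resp-≗ (initial N y) (initial-cong x≗y) run
    ... | c' , run' , c≗c' =
      trans (sym (out j))
            (trans (c≗c' (outEdge j))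
                   (correct y c' run' (λ e p he → trans (sym (c≗c' e)) (halted e p he)) j))

    -- The empty configuration is already halted.
    f-0 : ∀ j → f (λ _ → 0) j ≡ 0
    f-0 j = trans (sym (correct (λ _ → 0) (initial N (λ _ → 0)) ε empty-halted j)) (empty (outEdge j))
      where
      empty : ∀ e → initial N (λ _ → 0) e ≡ 0
      empty (inj₁ _) = refl
      empty (inj₂ _) = refl
      empty-halted : Halted N (initial N (λ _ → 0))
      empty-halted e _ _ = empty e

    -- Run x to completion, then run y alongside the leftover output letters.
    f-+ : ∀ x y j → f (λ i → x i + y i) j ≡ f x j + f y j
    f-+ x y j with result x | result y
    ... | cx , runx , haltedx , outx | cy , runy , haltedy , outy
      with reachable-⊕ (initial N y) runx | reachable-⊕ cx runy
    ... | d₁ , run₁ , d₁≗ | d₂ , run₂ , d₂≗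
      with reachable-resp-≗ d₁ (λ e → trans (+-comm (initial N y e) (cx e)) (sym (d₁≗ e))) run₂
    ... | d₃ , run₃ , d₂≗d₃
      with reachable-resp-≗ (initial N (λ i → x i + y i)) (initial-⊕ x y) (run₁ ◅◅ run₃)
    ... | d , run , d₃≗d = begin
      f (λ i → x i + y i) j        ≡⟨ correct _ d run halted j ⟨
      d (outEdge j)                ≡⟨ final (outEdge j) ⟨
      cy (outEdge j) + cx (outEdge j) ≡⟨ cong₂ _+_ (outy j) (outx j) ⟩
      f y j + f x j                ≡⟨ +-comm (f y j) (f x j) ⟩
      f x j + f y j                ∎
      where
      open ≡-Reasoning
      final : ∀ e → cy e + cx e ≡ d e
      final e = trans (sym (d₂≗ e)) (trans (d₂≗d₃ e) (d₃≗d e))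
      halted : Halted N d
      halted e p he = trans (sym (final e)) (cong₂ _+_ (haltedy e p he) (haltedx e p he))

    computable⇒linear : IsLinear f
    computable⇒linear = (λ j i → f (δ i) j) , λ x j → begin
      f x j                                 ≡⟨ additive⇒linear (λ x → f x j) (λ x≗y → f-cong x≗y j) (f-0 j) (λ x y → f-+ x y j) x ⟩
      ∑[ i < k ] (x i * f (δ i) j)           ≡⟨ sum-cong-≗ (λ i → *-comm (x i) (f (δ i) j)) ⟩
      ∑[ i < k ] (f (δ i) j * x i)           ≡⟨ ∑≡sum-tabulate (λ i → f (δ i) j * x i) ⟩
      Vec.sum (Vec.tabulate λ i → f (δ i) j * x i) ∎
      where open ≡-Reasoning

headValue : ∀ {n ℓ} {kind : Fin n → Kind} → (Fin n → ℕ) → (Fin ℓ → ℕ) → Head ℓ kind → ℕ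
headValue onNode onOutput (node (v , _)) = onNode v
headValue onNode onOutput (output j)     = onOutput j
headValue onNode onOutput trash          = 0

search : ∀ {m} {P Q : Fin m → Set} → (∀ i → P i ⊎ Q i) → (∃ P) ⊎ (∀ i → Q i)
search {zero}  p⊎q = inj₂ λ ()
search {suc m} p⊎q with p⊎q zero | search (λ i → p⊎q (suc i))
... | inj₁ p₀ | _             = inj₁ (zero , p₀)
... | inj₂ _  | inj₁ (i , pᵢ) = inj₁ (suc i , pᵢ)
... | inj₂ q₀ | inj₂ qs       = inj₂ λ { zero → q₀ ; (suc i) → qs i }

module _ {k ℓ : ℕ} (N : Network k ℓ) where
  open Network N
  open Firing N

  edgeWeight : (Fin n → ℕ) → Fin ℓ → Edge k kind → ℕ
  edgeWeight weightⱼ j e = headValue weightⱼ (δ j) (head e)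

  edgeDepth : (Fin n → ℕ) → Edge k kind → ℕ
  edgeDepth depth e = headValue depth (λ _ → 0) (head e)

  -- The weight of a node for
  -- output j is the number of letters eventually arriving at output j per
  -- letter fed into it; the depth strictly decreases along the network, which
  -- bounds the length of every execution.  Dead nodes never receive a letter:
  -- they are fed only by dead nodes.
  record Certificate : Set where
    field
      dead   : Fin n → Bool
      weight : Fin ℓ → Fin n → ℕ
      depth  : Fin n → ℕ
      weight-balance : ∀ j v → dead v ≡ false → weight j v ≡ ∑out (edgeWeight (weight j) j) v
      depth-drop     : ∀ v → dead v ≡ false → suc (∑out (edgeDepth depth) v) ≤ depth v
      dead-fed       : ∀ e v p → head e ≡ node (v , p) → dead v ≡ true →
                       ∃ λ o → e ≡ inj₂ o × dead (proj₁ o) ≡ true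

    certifiedMap : (Fin k → ℕ) → Fin ℓ → ℕ
    certifiedMap x j = ∑[ i < k ] (x i * edgeWeight (weight j) j (inj₁ i))

  Active : Config N → Edge k kind → Set
  Active c e = ∃ λ p → head e ≡ node p × 1 ≤ c e

  Idle : Config N → Edge k kind → Set
  Idle c e = ∀ p → head e ≡ node p → c e ≡ 0

  active-or-idle : ∀ c e → Active c e ⊎ Idle c e
  active-or-idle c e with c e | head e
  ... | zero  | _        = inj₂ λ _ _ → refl
  ... | suc _ | node p   = inj₁ (p , refl , s≤s z≤n)
  ... | suc _ | output _ = inj₂ λ _ ()
  ... | suc _ | trash    = inj₂ λ _ ()

  progress : ∀ c → (∃ (Active c)) ⊎ Halted N c
  progress c with search (λ i → active-or-idle c (inj₁ i))
                | search (λ v → search (λ q → active-or-idle c (inj₂ (v , q))))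
  ... | inj₁ (i , a) | _                  = inj₁ (inj₁ i , a)
  ... | inj₂ _       | inj₁ (v , q , a)   = inj₁ (inj₂ (v , q) , a)
  ... | inj₂ idleᵢ   | inj₂ idleₒ         = inj₂ λ { (inj₁ i) → idleᵢ i ; (inj₂ (v , q)) → idleₒ v q }

  module Certified (C : Certificate) where
    open Certificate C

    ω : Fin ℓ → Edge k kind → ℕ
    ω j = edgeWeight (weight j) j

    d : Edge k kind → ℕ
    d = edgeDepth depth

    -- Invariant of every execution: dead nodes have emitted nothing.
    Quiet : Config N → Set
    Quiet c = ∀ v q → dead v ≡ true → c (inj₂ (v , q)) ≡ 0

    fed⇒live : ∀ c e v p → Quiet c → head e ≡ node (v , p) → 1 ≤ c e → dead v ≡ false
    fed⇒live c e v p quiet he 1≤ce with dead v in dv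
    ... | false = refl
    ... | true with dead-fed e v p he dv
    ...   | (u , q) , refl , du with c (inj₂ (u , q)) | quiet u q du
    ...     | .0 | refl with 1≤ce
    ...       | ()

    quiet-step : ∀ {c c'} → Step N c c' → Quiet c → Quiet c'
    quiet-step (step c e (v , p) he 1≤ce) quiet u q du =
      m+n≡0⇒m≡0 _ (trans (fire-balance c e v p 1≤ce (inj₂ (u , q)))
                         (cong₂ _+_ (quiet u q du) nothing-emitted))
      where
      nothing-emitted : emitted N v p (inj₂ (u , q)) ≡ 0
      nothing-emitted with u ≟ v
      ... | no  _    = refl
      ... | yes refl with trans (sym du) (fed⇒live c e u p quiet he 1≤ce)
      ...   | ()

    weight-step : ∀ {c c'} → Step N c c' → Quiet c → ∀ j → ⟪ c' ∣ ω j ⟫ ≡ ⟪ c ∣ ω j ⟫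
    weight-step (step c e (v , p) he 1≤ce) quiet j = +-cancelʳ-≡ (ω j e) _ _ (begin
      ⟪ fire N c e (v , p) ∣ ω j ⟫ + ω j e  ≡⟨ ⟪fire∣⟫ c e v p 1≤ce (ω j) ⟩
      ⟪ c ∣ ω j ⟫ + ∑out (ω j) v            ≡⟨ cong (⟪ c ∣ ω j ⟫ +_) balance ⟨
      ⟪ c ∣ ω j ⟫ + ω j e                   ∎)
      where
      open ≡-Reasoning
      balance : ω j e ≡ ∑out (ω j) v
      balance = trans (cong (headValue (weight j) (δ j)) he)
                      (weight-balance j v (fed⇒live c e v p quiet he 1≤ce))

    depth-step : ∀ c e v p → head e ≡ node (v , p) → 1 ≤ c e → Quiet c →
                 suc ⟪ fire N c e (v , p) ∣ d ⟫ ≤ ⟪ c ∣ d ⟫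
    depth-step c e v p he 1≤ce quiet = +-cancelʳ-≤ (∑out d v) _ _ (begin
      suc ⟪ c' ∣ d ⟫ + ∑out d v   ≡⟨ +-suc ⟪ c' ∣ d ⟫ (∑out d v) ⟨
      ⟪ c' ∣ d ⟫ + suc (∑out d v) ≤⟨ +-monoʳ-≤ ⟪ c' ∣ d ⟫ decrease ⟩
      ⟪ c' ∣ d ⟫ + d e           ≡⟨ ⟪fire∣⟫ c e v p 1≤ce d ⟩
      ⟪ c ∣ d ⟫ + ∑out d v        ∎)
      where
      open ≤-Reasoning
      c' : Config N
      c' = fire N c e (v , p)
      decrease : suc (∑out d v) ≤ d e
      decrease = subst (suc (∑out d v) ≤_) (sym (cong (headValue depth (λ _ → 0)) he))
                   (depth-drop v (fed⇒live c e v p quiet he 1≤ce))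

    reachable-invariant : ∀ {c c'} → Reachable N c c' → Quiet c →
                          Quiet c' × (∀ j → ⟪ c' ∣ ω j ⟫ ≡ ⟪ c ∣ ω j ⟫)
    reachable-invariant ε        quiet = quiet , λ j → refl
    reachable-invariant (s ◅ ss) quiet with reachable-invariant ss (quiet-step s quiet)
    ... | quiet' , conserved = quiet' , λ j → trans (conserved j) (weight-step s quiet j)

    -- Firing any active edge as long as there is one reaches a halted
    -- configuration after at most ⟪ c ∣ d ⟫ steps.
    halts : ∀ b c → ⟪ c ∣ d ⟫ ≤ b → Quiet c → ∃ λ c' → Reachable N c c' × Halted N c'
    halts b c bound quiet with progress c
    ... | inj₂ halted = c , ε , halted
    ... | inj₁ (e , (v , p) , he , 1≤ce) with depth-step c e v p he 1≤ce quiet | b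
    ...   | decrease | zero with ≤-trans decrease bound
    ...     | ()
    halts b c bound quiet | inj₁ (e , (v , p) , he , 1≤ce) | decrease | suc b'
      with halts b' (fire N c e (v , p)) (≤-pred (≤-trans decrease bound))
                 (quiet-step (step c e (v , p) he 1≤ce) quiet)
    ... | c' , run , halted = c' , step c e (v , p) he 1≤ce ◅ run , halted

    halted-weight : ∀ c → Halted N c → ∀ j → ⟪ c ∣ ω j ⟫ ≡ outputs N c j
    halted-weight c halted j = trans (∑E-select (outEdge j) others) (begin
      c (outEdge j) * ω j (outEdge j)  ≡⟨ cong (λ h → c (outEdge j) * headValue (weight j) (δ j) h) (outEdge-head j) ⟩
      c (outEdge j) * δ j j            ≡⟨ cong (c (outEdge j) *_) (δ-diag j) ⟩
      c (outEdge j) * 1                ≡⟨ *-identityʳ _ ⟩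
      c (outEdge j)                    ∎)
      where
      open ≡-Reasoning
      others : ∀ e → e ≢ outEdge j → c e * ω j e ≡ 0
      others e e≢out with head e in he
      ... | node p    = cong (_* _) (halted e p he)
      ... | trash     = *-zeroʳ (c e)
      ... | output j' with j ≟ j'
      ...   | yes refl = ⊥-elim (e≢out (outEdge-unique j e he))
      ...   | no  _    = *-zeroʳ (c e)

    initial-weight : ∀ x j → ⟪ initial N x ∣ ω j ⟫ ≡ certifiedMap x j
    initial-weight x j =
      trans (cong (certifiedMap x j +_)
                  (∑-zero {g = λ v → ∑out (λ _ → 0) v} (λ v → sum-replicate-zero (outdeg (kind v)))))
            (+-identityʳ _)

    initial-quiet : ∀ x → Quiet (initial N x)
    initial-quiet x v q _ = refl

    halted-output : ∀ x c → Reachable N (initial N x) c → Halted N c → ∀ j → outputs N c j ≡ certifiedMap x j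
    halted-output x c run halted j = begin
      outputs N c j          ≡⟨ halted-weight c halted j ⟨
      ⟪ c ∣ ω j ⟫            ≡⟨ proj₂ (reachable-invariant run (initial-quiet x)) j ⟩
      ⟪ initial N x ∣ ω j ⟫  ≡⟨ initial-weight x j ⟩
      certifiedMap x j       ∎
      where open ≡-Reasoning

    computes : Computes N certifiedMap
    computes x with halts _ (initial N x) ≤-refl (initial-quiet x)
    ... | c , run , halted = (c , run , halted , halted-output x c run halted) , halted-output x

-- Concrete networks are easier to describe with structured node names;
-- this module turns such a description, and a certificate phrased in terms of
-- it, into a Network and a Certificate.
module Presented {k ℓ n : ℕ} {Node : Set} (enumerate : Node ↔ Fin n) (kindᴾ : Node → Kind) where
  open Inverse enumerate using (to; from; strictlyInverseˡ; strictlyInverseʳ)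

  OutPortᴾ InPortᴾ Edgeᴾ : Set
  OutPortᴾ = Σ Node λ u → Fin (outdeg (kindᴾ u))
  InPortᴾ  = Σ Node λ u → Fin (indeg (kindᴾ u))
  Edgeᴾ    = Fin k ⊎ OutPortᴾ

  data Headᴾ : Set where
    nodeᴾ   : InPortᴾ → Headᴾ
    outputᴾ : Fin ℓ → Headᴾ
    trashᴾ  : Headᴾ

  record Wiring : Set where
    field
      headᴾ           : Edgeᴾ → Headᴾ
      input-headᴾ     : ∀ i → ∃ λ p → headᴾ (inj₁ i) ≡ nodeᴾ p
      inEdgeᴾ         : InPortᴾ → Edgeᴾ
      inEdge-headᴾ    : ∀ p → headᴾ (inEdgeᴾ p) ≡ nodeᴾ p
      inEdge-uniqueᴾ  : ∀ p e → headᴾ e ≡ nodeᴾ p → e ≡ inEdgeᴾ p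
      outEdgeᴾ        : Fin ℓ → Edgeᴾ
      outEdge-headᴾ   : ∀ j → headᴾ (outEdgeᴾ j) ≡ outputᴾ j
      outEdge-uniqueᴾ : ∀ j e → headᴾ e ≡ outputᴾ j → e ≡ outEdgeᴾ j

  kind : Fin n → Kind
  kind v = kindᴾ (from v)

  module Ports (P : Node → Set) where
    encode : Σ Node P → Σ (Fin n) (P ∘′ from)
    encode (u , q) = to u , subst P (sym (strictlyInverseʳ u)) q

    decode : Σ (Fin n) (P ∘′ from) → Σ Node P
    decode (v , q) = from v , q

    decode-encode : ∀ x → decode (encode x) ≡ x
    decode-encode (u , q) = lemma (strictlyInverseʳ u)
      where
      lemma : ∀ {w} (w≡u : w ≡ u) → _≡_ {A = Σ Node P} (w , subst P (sym w≡u) q) (u , q)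
      lemma refl = refl

    encode-decode : ∀ x → encode (decode x) ≡ x
    encode-decode (v , q) = lemma (strictlyInverseˡ v) (sym (strictlyInverseʳ (from v)))
      where
      lemma : ∀ {v'} (v'≡v : v' ≡ v) (eq : from v ≡ from v') →
              _≡_ {A = Σ (Fin n) (P ∘′ from)} (v' , subst P eq q) (v , q)
      lemma refl refl = refl

  module Out = Ports (λ u → Fin (outdeg (kindᴾ u)))
  module In  = Ports (λ u → Fin (indeg (kindᴾ u)))

  encodeEdge : Edgeᴾ → Edge k kind
  encodeEdge (inj₁ i) = inj₁ i
  encodeEdge (inj₂ o) = inj₂ (Out.encode o)

  decodeEdge : Edge k kind → Edgeᴾ
  decodeEdge (inj₁ i) = inj₁ i
  decodeEdge (inj₂ o) = inj₂ (Out.decode o)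

  decode-encodeEdge : ∀ e → decodeEdge (encodeEdge e) ≡ e
  decode-encodeEdge (inj₁ i) = refl
  decode-encodeEdge (inj₂ o) = cong inj₂ (Out.decode-encode o)

  encode-decodeEdge : ∀ e → encodeEdge (decodeEdge e) ≡ e
  encode-decodeEdge (inj₁ i) = refl
  encode-decodeEdge (inj₂ o) = cong inj₂ (Out.encode-decode o)

  encodeHead : Headᴾ → Head ℓ kind
  encodeHead (nodeᴾ p)   = node (In.encode p)
  encodeHead (outputᴾ j) = output j
  encodeHead trashᴾ      = trash

  encodeHead-node : ∀ {h p} → encodeHead h ≡ node p → h ≡ nodeᴾ (In.decode p)
  encodeHead-node {nodeᴾ p} refl = cong nodeᴾ (sym (In.decode-encode p))

  encodeHead-output : ∀ {h j} → encodeHead h ≡ output j → h ≡ outputᴾ j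
  encodeHead-output {outputᴾ _} refl = refl

  network : Wiring → Network k ℓ
  network W = record
    { n              = n
    ; kind           = kind
    ; head           = λ e → encodeHead (headᴾ (decodeEdge e))
    ; input-head     = λ i → In.encode (proj₁ (input-headᴾ i)) , cong encodeHead (proj₂ (input-headᴾ i))
    ; inEdge         = λ p → encodeEdge (inEdgeᴾ (In.decode p))
    ; inEdge-head    = λ p → begin
        encodeHead (headᴾ (decodeEdge (encodeEdge (inEdgeᴾ (In.decode p)))))
          ≡⟨ cong (λ e → encodeHead (headᴾ e)) (decode-encodeEdge _) ⟩
        encodeHead (headᴾ (inEdgeᴾ (In.decode p)))
          ≡⟨ cong encodeHead (inEdge-headᴾ (In.decode p)) ⟩
        node (In.encode (In.decode p))
          ≡⟨ cong node (In.encode-decode p) ⟩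
        node p ∎
    ; inEdge-unique  = λ p e he →
        trans (sym (encode-decodeEdge e)) (cong encodeEdge (inEdge-uniqueᴾ _ _ (encodeHead-node he)))
    ; outEdge        = λ j → encodeEdge (outEdgeᴾ j)
    ; outEdge-head   = λ j →
        trans (cong (λ e → encodeHead (headᴾ e)) (decode-encodeEdge _)) (cong encodeHead (outEdge-headᴾ j))
    ; outEdge-unique = λ j e he →
        trans (sym (encode-decodeEdge e)) (cong encodeEdge (outEdge-uniqueᴾ _ _ (encodeHead-output he)))
    }
    where
    open Wiring W
    open ≡-Reasoning

  headValueᴾ : (Node → ℕ) → (Fin ℓ → ℕ) → Headᴾ → ℕ
  headValueᴾ onNode onOutput (nodeᴾ (u , _)) = onNode u
  headValueᴾ onNode onOutput (outputᴾ j)     = onOutput j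
  headValueᴾ onNode onOutput trashᴾ          = 0

  headValue-encode : ∀ onNode onOutput h →
    headValue (onNode ∘′ from) onOutput (encodeHead h) ≡ headValueᴾ onNode onOutput h
  headValue-encode onNode onOutput (nodeᴾ (u , _)) = cong onNode (strictlyInverseʳ u)
  headValue-encode onNode onOutput (outputᴾ j)     = refl
  headValue-encode onNode onOutput trashᴾ          = refl

  module _ (W : Wiring) where
    open Wiring W

    ∑outᴾ : (Edgeᴾ → ℕ) → Node → ℕ
    ∑outᴾ w u = ∑[ q < outdeg (kindᴾ u) ] w (inj₂ (u , q))

    record Certificateᴾ : Set where
      field
        deadᴾ   : Node → Bool
        weightᴾ : Fin ℓ → Node → ℕ
        depthᴾ  : Node → ℕ
        weight-balanceᴾ : ∀ j u → deadᴾ u ≡ false →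
                          weightᴾ j u ≡ ∑outᴾ (λ e → headValueᴾ (weightᴾ j) (δ j) (headᴾ e)) u
        depth-dropᴾ     : ∀ u → deadᴾ u ≡ false →
                          suc (∑outᴾ (λ e → headValueᴾ depthᴾ (λ _ → 0) (headᴾ e)) u) ≤ depthᴾ u
        dead-fedᴾ       : ∀ e u p → headᴾ e ≡ nodeᴾ (u , p) → deadᴾ u ≡ true →
                          ∃ λ o → e ≡ inj₂ o × deadᴾ (proj₁ o) ≡ true

      certifiedMapᴾ : (Fin k → ℕ) → Fin ℓ → ℕ
      certifiedMapᴾ x j = ∑[ i < k ] (x i * headValueᴾ (weightᴾ j) (δ j) (headᴾ (inj₁ i)))

    module _ (C : Certificateᴾ) where
      open Certificateᴾ C

      certificate : Certificate (network W)
      certificate = record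
        { dead           = deadᴾ ∘′ from
        ; weight         = λ j → weightᴾ j ∘′ from
        ; depth          = depthᴾ ∘′ from
        ; weight-balance = λ j v dv → trans (weight-balanceᴾ j (from v) dv)
            (sum-cong-≗ (λ q → sym (headValue-encode (weightᴾ j) (δ j) (headᴾ (inj₂ (from v , q))))))
        ; depth-drop     = λ v dv → subst (λ s → suc s ≤ depthᴾ (from v))
            (sum-cong-≗ (λ q → sym (headValue-encode depthᴾ (λ _ → 0) (headᴾ (inj₂ (from v , q))))))
            (depth-dropᴾ (from v) dv)
        ; dead-fed       = dead-fed
        }
        where
        dead-fed : ∀ e v p → encodeHead (headᴾ (decodeEdge e)) ≡ node (v , p) → deadᴾ (from v) ≡ true →
                   ∃ λ o → e ≡ inj₂ o × deadᴾ (from (proj₁ o)) ≡ true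
        dead-fed e v p he dv with dead-fedᴾ (decodeEdge e) (from v) p (encodeHead-node he) dv
        ... | o , e≡o , dead-o = Out.encode o ,
                             trans (sym (encode-decodeEdge e)) (cong encodeEdge e≡o) ,
                             trans (cong deadᴾ (strictlyInverseʳ (proj₁ o))) dead-o

      certifiedMap-encode : ∀ x j → Certificate.certifiedMap certificate x j ≡ certifiedMapᴾ x j
      certifiedMap-encode x j =
        sum-cong-≗ (λ i → cong (x i *_) (headValue-encode (weightᴾ j) (δ j) (headᴾ (inj₁ i))))

module _ {k ℓ : ℕ} where

  match : Fin k × Fin ℓ → Fin k × Fin ℓ → ℕ
  match (i , j) (i' , j') = δ i' i * δ j' j

  occurrences : Fin k × Fin ℓ → List (Fin k × Fin ℓ) → ℕ
  occurrences p []       = 0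
  occurrences p (x ∷ xs) = match p x + occurrences p xs

  occurrences-++ : ∀ p xs ys → occurrences p (xs ++ ys) ≡ occurrences p xs + occurrences p ys
  occurrences-++ p []       ys = refl
  occurrences-++ p (x ∷ xs) ys =
    trans (cong (match p x +_) (occurrences-++ p xs ys)) (sym (+-assoc (match p x) _ _))

  occurrences-concat : ∀ p {m} (xss : Fin m → List (Fin k × Fin ℓ)) →
    occurrences p (concat (tabulate xss)) ≡ ∑[ a < m ] occurrences p (xss a)
  occurrences-concat p {zero}  xss = refl
  occurrences-concat p {suc m} xss =
    trans (occurrences-++ p (xss zero) _)
          (cong (occurrences p (xss zero) +_) (occurrences-concat p (λ a → xss (suc a))))

  occurrences-replicate : ∀ p r x → occurrences p (replicate r x) ≡ r * match p x
  occurrences-replicate p zero    x = refl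
  occurrences-replicate p (suc r) x = cong (match p x +_) (occurrences-replicate p r x)

drop-lookup : ∀ {A : Set} (xs : List A) (s : Fin (length xs)) →
              drop (toℕ s) xs ≡ lookup xs s ∷ drop (suc (toℕ s)) xs
drop-lookup (x ∷ xs) zero    = refl
drop-lookup (x ∷ xs) (suc s) = drop-lookup xs s

∸-suc : ∀ {t M} → t < M → M ∸ t ≡ suc (M ∸ suc t)
∸-suc {zero}  {suc M} _         = refl
∸-suc {suc t} {suc M} (s≤s t<M) = ∸-suc t<M

data Position (M : ℕ) : Fin (suc M) → Set where
  stage : (s : Fin M) → Position M (inject₁ s)
  end   : Position M (fromℕ M)

position : ∀ {M} (m : Fin (suc M)) → Position M m
position {zero}  zero    = end
position {suc M} zero    = stage zero
position {suc M} (suc m) = next (position m)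
  where
  next : ∀ {m} → Position M m → Position (suc M) (suc m)
  next (stage s) = stage (suc s)
  next end       = end

position-stage : ∀ {M} (s : Fin M) → position (inject₁ s) ≡ stage s
position-stage {suc M} zero    = refl
position-stage {suc M} (suc s) rewrite position-stage s = refl

position-end : ∀ M → position (fromℕ M) ≡ end
position-end zero    = refl
position-end (suc M) rewrite position-end M = refl

-- The list `stages` contains the pair (i , j)
-- L j i times; write M for its length.  Input i runs down a chain of splitters
-- S i 0, …, S i M; at stage s with pair (i , j) the splitter S i s passes a
-- copy to the adder A j s of the chain A j 0, …, A j M that ends at output j.
-- Adder inputs not fed in this way are fed by dead splitters D j m and E j,
-- each looping one output back into itself; the last splitters drop letters.
module MatrixNetwork {k ℓ : ℕ} (L : Fin ℓ → Fin k → ℕ) where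

  stages : List (Fin k × Fin ℓ)
  stages = concat (tabulate λ i → concat (tabulate λ j → replicate (L j i) (i , j)))

  occurrences-stages : ∀ i₀ j₀ → occurrences (i₀ , j₀) stages ≡ L j₀ i₀
  occurrences-stages i₀ j₀ = begin
    occurrences (i₀ , j₀) stages
      ≡⟨ occurrences-concat (i₀ , j₀) (λ i → concat (tabulate λ j → replicate (L j i) (i , j))) ⟩
    ∑[ i < k ] occurrences (i₀ , j₀) (concat (tabulate λ j → replicate (L j i) (i , j)))
      ≡⟨ sum-cong-≗ (λ i → trans (occurrences-concat (i₀ , j₀) (λ j → replicate (L j i) (i , j)))
                                 (sum-cong-≗ (λ j → occurrences-replicate _ (L j i) _))) ⟩
    ∑[ i < k ] ∑[ j < ℓ ] (L j i * (δ i i₀ * δ j j₀))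
      ≡⟨ sum-cong-≗ (λ i → sum-cong-≗ (λ j → sym (*-assoc (L j i) (δ i i₀) (δ j j₀)))) ⟩
    ∑[ i < k ] ∑[ j < ℓ ] (L j i * δ i i₀ * δ j j₀)
      ≡⟨ sum-cong-≗ (λ i → ∑-δ (λ j → L j i * δ i i₀) j₀) ⟩
    ∑[ i < k ] (L j₀ i * δ i i₀)
      ≡⟨ ∑-δ (L j₀) i₀ ⟩
    L j₀ i₀ ∎
    where open ≡-Reasoning

  M : ℕ
  M = length stages

  input-of : Fin M → Fin k
  input-of s = proj₁ (lookup stages s)

  output-of : Fin M → Fin ℓ
  output-of s = proj₂ (lookup stages s)

  data Node : Set where
    S : Fin k → Fin (suc M) → Node
    A : Fin ℓ → Fin (suc M) → Node
    D : Fin ℓ → Fin (suc M) → Node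
    E : Fin ℓ → Node

  kindᴾ : Node → Kind
  kindᴾ (S _ _) = splitter
  kindᴾ (A _ _) = adder
  kindᴾ (D _ _) = splitter
  kindᴾ (E _)   = splitter

  Shape : Set
  Shape = (Fin k × Fin (suc M)) ⊎ ((Fin ℓ × Fin (suc M)) ⊎ ((Fin ℓ × Fin (suc M)) ⊎ Fin ℓ))

  size : ℕ
  size = k * suc M + (ℓ * suc M + (ℓ * suc M + ℓ))

  enumerate : Node ↔ Fin size
  enumerate = ↔-trans toShape
    (↔-sym (↔-trans +↔⊎ (*↔× ⊎-↔ ↔-trans +↔⊎ (*↔× ⊎-↔ ↔-trans +↔⊎ (*↔× ⊎-↔ ↔-refl)))))
    where
    to : Node → Shape
    to (S i m) = inj₁ (i , m)
    to (A j m) = inj₂ (inj₁ (j , m))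
    to (D j m) = inj₂ (inj₂ (inj₁ (j , m)))
    to (E j)   = inj₂ (inj₂ (inj₂ j))
    from : Shape → Node
    from (inj₁ (i , m))               = S i m
    from (inj₂ (inj₁ (j , m)))        = A j m
    from (inj₂ (inj₂ (inj₁ (j , m)))) = D j m
    from (inj₂ (inj₂ (inj₂ j)))       = E j
    to-from : ∀ x → to (from x) ≡ x
    to-from (inj₁ _)               = refl
    to-from (inj₂ (inj₁ _))        = refl
    to-from (inj₂ (inj₂ (inj₁ _))) = refl
    to-from (inj₂ (inj₂ (inj₂ _))) = refl
    from-to : ∀ u → from (to u) ≡ u
    from-to (S _ _) = refl
    from-to (A _ _) = refl
    from-to (D _ _) = refl
    from-to (E _)   = refl
    toShape : Node ↔ Shape
    toShape = mk↔ₛ′ to from to-from from-to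

  open Presented {k} {ℓ} enumerate kindᴾ

  -- Heads of the output edges of nodes at position m, by the shape of m:
  -- the next splitter, the copy (to an adder of the stage's output, if the
  -- stage belongs to input i), the next adder, and the spare output of D j m.
  splitterNext : Fin k → ∀ {m} → Position M m → Headᴾ
  splitterNext i (stage s) = nodeᴾ (S i (suc s) , zero)
  splitterNext i end       = trashᴾ

  copyHead : Fin k → ∀ {m} → Position M m → Headᴾ
  copyHead i (stage s) with input-of s ≟ i
  ... | yes _ = nodeᴾ (A (output-of s) (inject₁ s) , suc zero)
  ... | no  _ = trashᴾ
  copyHead i end = trashᴾ

  adderNext : Fin ℓ → ∀ {m} → Position M m → Headᴾ
  adderNext j (stage s) = nodeᴾ (A j (suc s) , zero)
  adderNext j end       = outputᴾ j

  spareHead : Fin ℓ → ∀ {m} → Position M m → Headᴾ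
  spareHead j (stage s) with output-of s ≟ j
  ... | yes _ = trashᴾ
  ... | no  _ = nodeᴾ (A j (inject₁ s) , suc zero)
  spareHead j end = nodeᴾ (A j (fromℕ M) , suc zero)

  adderFeed : Fin ℓ → ∀ {m} → Position M m → Edgeᴾ
  adderFeed j (stage s) with output-of s ≟ j
  ... | yes _ = inj₂ (S (input-of s) (inject₁ s) , suc zero)
  ... | no  _ = inj₂ (D j (inject₁ s) , suc zero)
  adderFeed j end = inj₂ (D j (fromℕ M) , suc zero)

  copyHead-own : ∀ s → copyHead (input-of s) (stage s) ≡ nodeᴾ (A (output-of s) (inject₁ s) , suc zero)
  copyHead-own s with input-of s ≟ input-of s
  ... | yes _ = refl
  ... | no  ≢ = ⊥-elim (≢ refl)

  spareHead-free : ∀ {j} s → output-of s ≢ j → spareHead j (stage s) ≡ nodeᴾ (A j (inject₁ s) , suc zero)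
  spareHead-free {j} s ≢j with output-of s ≟ j
  ... | yes ≡j = ⊥-elim (≢j ≡j)
  ... | no  _  = refl

  adderFeed-own : ∀ s → adderFeed (output-of s) (stage s) ≡ inj₂ (S (input-of s) (inject₁ s) , suc zero)
  adderFeed-own s with output-of s ≟ output-of s
  ... | yes _ = refl
  ... | no  ≢ = ⊥-elim (≢ refl)

  adderFeed-free : ∀ {j} s → output-of s ≢ j → adderFeed j (stage s) ≡ inj₂ (D j (inject₁ s) , suc zero)
  adderFeed-free {j} s ≢j with output-of s ≟ j
  ... | yes ≡j = ⊥-elim (≢j ≡j)
  ... | no  _  = refl

  headᴾ : Edgeᴾ → Headᴾ
  headᴾ (inj₁ i)                  = nodeᴾ (S i zero , zero)
  headᴾ (inj₂ (S i m , zero))     = splitterNext i (position m)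
  headᴾ (inj₂ (S i m , suc zero)) = copyHead i (position m)
  headᴾ (inj₂ (A j m , zero))     = adderNext j (position m)
  headᴾ (inj₂ (D j m , zero))     = nodeᴾ (D j m , zero)
  headᴾ (inj₂ (D j m , suc zero)) = spareHead j (position m)
  headᴾ (inj₂ (E j , zero))       = nodeᴾ (E j , zero)
  headᴾ (inj₂ (E j , suc zero))   = nodeᴾ (A j zero , zero)

  splitterFeed : Fin k → Fin (suc M) → Edgeᴾ
  splitterFeed i zero    = inj₁ i
  splitterFeed i (suc m) = inj₂ (S i (inject₁ m) , zero)

  adderChainFeed : Fin ℓ → Fin (suc M) → Edgeᴾ
  adderChainFeed j zero    = inj₂ (E j , suc zero)
  adderChainFeed j (suc m) = inj₂ (A j (inject₁ m) , zero)

  inEdgeᴾ : InPortᴾ → Edgeᴾ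
  inEdgeᴾ (S i m , zero)     = splitterFeed i m
  inEdgeᴾ (A j m , zero)     = adderChainFeed j m
  inEdgeᴾ (A j m , suc zero) = adderFeed j (position m)
  inEdgeᴾ (D j m , zero)     = inj₂ (D j m , zero)
  inEdgeᴾ (E j , zero)       = inj₂ (E j , zero)

  outEdgeᴾ : Fin ℓ → Edgeᴾ
  outEdgeᴾ j = inj₂ (A j (fromℕ M) , zero)

  adderFeed-head : ∀ j {m} (pos : Position M m) → headᴾ (adderFeed j pos) ≡ nodeᴾ (A j m , suc zero)
  adderFeed-head j end = cong (spareHead j) (position-end M)
  adderFeed-head j (stage s) with output-of s ≟ j
  ... | yes refl = trans (cong (copyHead (input-of s)) (position-stage s)) (copyHead-own s)
  ... | no  ≢j   = trans (cong (spareHead j) (position-stage s)) (spareHead-free s ≢j)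

  copyHead-unique : ∀ i {m} (pos : Position M m) p → copyHead i pos ≡ nodeᴾ p →
                    inj₂ (S i m , suc zero) ≡ inEdgeᴾ p
  copyHead-unique i (stage s) p he with input-of s ≟ i
  copyHead-unique _ (stage s) _ refl | yes refl =
    sym (trans (cong (adderFeed (output-of s)) (position-stage s)) (adderFeed-own s))

  spareHead-unique : ∀ j {m} (pos : Position M m) p → spareHead j pos ≡ nodeᴾ p →
                     inj₂ (D j m , suc zero) ≡ inEdgeᴾ p
  spareHead-unique j end _ refl = sym (cong (adderFeed j) (position-end M))
  spareHead-unique j (stage s) p he with output-of s ≟ j
  spareHead-unique j (stage s) _ refl | no ≢j =
    sym (trans (cong (adderFeed j) (position-stage s)) (adderFeed-free s ≢j))

  splitterNext-unique : ∀ i {m} (pos : Position M m) p → splitterNext i pos ≡ nodeᴾ p →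
                        inj₂ (S i m , zero) ≡ inEdgeᴾ p
  splitterNext-unique i (stage s) _ refl = refl

  adderNext-unique : ∀ j {m} (pos : Position M m) p → adderNext j pos ≡ nodeᴾ p →
                     inj₂ (A j m , zero) ≡ inEdgeᴾ p
  adderNext-unique j (stage s) _ refl = refl

  inEdge-headᴾ : ∀ p → headᴾ (inEdgeᴾ p) ≡ nodeᴾ p
  inEdge-headᴾ (S i zero , zero)    = refl
  inEdge-headᴾ (S i (suc m) , zero) = cong (splitterNext i) (position-stage m)
  inEdge-headᴾ (A j zero , zero)    = refl
  inEdge-headᴾ (A j (suc m) , zero) = cong (adderNext j) (position-stage m)
  inEdge-headᴾ (A j m , suc zero)   = adderFeed-head j (position m)
  inEdge-headᴾ (D j m , zero)       = refl
  inEdge-headᴾ (E j , zero)         = refl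

  inEdge-uniqueᴾ : ∀ p e → headᴾ e ≡ nodeᴾ p → e ≡ inEdgeᴾ p
  inEdge-uniqueᴾ _ (inj₁ i)                  refl = refl
  inEdge-uniqueᴾ p (inj₂ (S i m , zero))     he   = splitterNext-unique i (position m) p he
  inEdge-uniqueᴾ p (inj₂ (S i m , suc zero)) he   = copyHead-unique i (position m) p he
  inEdge-uniqueᴾ p (inj₂ (A j m , zero))     he   = adderNext-unique j (position m) p he
  inEdge-uniqueᴾ _ (inj₂ (D j m , zero))     refl = refl
  inEdge-uniqueᴾ p (inj₂ (D j m , suc zero)) he   = spareHead-unique j (position m) p he
  inEdge-uniqueᴾ _ (inj₂ (E j , zero))       refl = refl
  inEdge-uniqueᴾ _ (inj₂ (E j , suc zero))   refl = refl

  outEdge-headᴾ : ∀ j → headᴾ (outEdgeᴾ j) ≡ outputᴾ j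
  outEdge-headᴾ j = cong (adderNext j) (position-end M)

  splitterNext-internal : ∀ i {m} (pos : Position M m) {j} → splitterNext i pos ≢ outputᴾ j
  splitterNext-internal i (stage s) ()
  splitterNext-internal i end       ()

  copyHead-internal : ∀ i {m} (pos : Position M m) {j} → copyHead i pos ≢ outputᴾ j
  copyHead-internal i (stage s) he with input-of s ≟ i
  copyHead-internal i (stage s) () | yes _
  copyHead-internal i (stage s) () | no  _
  copyHead-internal i end ()

  spareHead-internal : ∀ j' {m} (pos : Position M m) {j} → spareHead j' pos ≢ outputᴾ j
  spareHead-internal j' (stage s) he with output-of s ≟ j'
  spareHead-internal j' (stage s) () | yes _
  spareHead-internal j' (stage s) () | no  _
  spareHead-internal j' end ()

  adderNext-unique-output : ∀ j' {m} (pos : Position M m) j → adderNext j' pos ≡ outputᴾ j →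
                            inj₂ (A j' m , zero) ≡ outEdgeᴾ j
  adderNext-unique-output j' end _ refl = refl

  outEdge-uniqueᴾ : ∀ j e → headᴾ e ≡ outputᴾ j → e ≡ outEdgeᴾ j
  outEdge-uniqueᴾ j (inj₁ i) ()
  outEdge-uniqueᴾ j (inj₂ (S i m , zero))     he = ⊥-elim (splitterNext-internal i (position m) he)
  outEdge-uniqueᴾ j (inj₂ (S i m , suc zero)) he = ⊥-elim (copyHead-internal i (position m) he)
  outEdge-uniqueᴾ j (inj₂ (A j' m , zero))    he = adderNext-unique-output j' (position m) j he
  outEdge-uniqueᴾ j (inj₂ (D j' m , zero))    ()
  outEdge-uniqueᴾ j (inj₂ (D j' m , suc zero)) he = ⊥-elim (spareHead-internal j' (position m) he)
  outEdge-uniqueᴾ j (inj₂ (E j' , zero))      ()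
  outEdge-uniqueᴾ j (inj₂ (E j' , suc zero))  ()

  wiring : Wiring
  wiring = record
    { headᴾ           = headᴾ
    ; input-headᴾ     = λ i → (S i zero , zero) , refl
    ; inEdgeᴾ         = inEdgeᴾ
    ; inEdge-headᴾ    = inEdge-headᴾ
    ; inEdge-uniqueᴾ  = inEdge-uniqueᴾ
    ; outEdgeᴾ        = outEdgeᴾ
    ; outEdge-headᴾ   = outEdge-headᴾ
    ; outEdge-uniqueᴾ = outEdge-uniqueᴾ
    }

  -- Weights: a letter entering S i m reaches output j once for every later
  -- stage with pair (i , j); a letter entering A j' m reaches output j' only.
  weightᴾ : Fin ℓ → Node → ℕ
  weightᴾ j (S i m)  = occurrences (i , j) (drop (toℕ m) stages)
  weightᴾ j (A j' m) = δ j' j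
  weightᴾ j (D _ _)  = 0
  weightᴾ j (E _)    = 0

  -- Depths: adders count the remaining stages; a splitter dominates the
  -- splitter after it together with any adder.
  remaining : Fin (suc M) → ℕ
  remaining m = M ∸ toℕ m

  depthᴾ : Node → ℕ
  depthᴾ (S i m) = suc (remaining m) * (2 + M)
  depthᴾ (A j m) = suc (remaining m)
  depthᴾ (D _ _) = 0
  depthᴾ (E _)   = 0

  deadᴾ : Node → Bool
  deadᴾ (S _ _) = false
  deadᴾ (A _ _) = false
  deadᴾ (D _ _) = true
  deadᴾ (E _)   = true

  remaining-stage : ∀ s → remaining (inject₁ s) ≡ suc (remaining (suc s))
  remaining-stage s = trans (cong (M ∸_) (toℕ-inject₁ s)) (∸-suc (toℕ<n s))

  suffix-stage : ∀ s → drop (toℕ (inject₁ s)) stages ≡ lookup stages s ∷ drop (toℕ (suc s)) stages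
  suffix-stage s = trans (cong (λ t → drop t stages) (toℕ-inject₁ s)) (drop-lookup stages s)

  suffix-end : drop (toℕ (fromℕ M)) stages ≡ []
  suffix-end = trans (cong (λ t → drop t stages) (toℕ-fromℕ M)) (drop-all M stages ≤-refl)

  weightOf : Fin ℓ → Headᴾ → ℕ
  weightOf j = headValueᴾ (weightᴾ j) (δ j)

  depthOf : Headᴾ → ℕ
  depthOf = headValueᴾ depthᴾ (λ _ → 0)

  copy-weight : ∀ i j s → weightOf j (copyHead i (stage s)) ≡ match (i , j) (lookup stages s)
  copy-weight i j s with input-of s ≟ i
  ... | yes refl = sym (+-identityʳ _)
  ... | no  _    = refl

  copy-depth : ∀ i s → depthOf (copyHead i (stage s)) ≤ suc M
  copy-depth i s with input-of s ≟ i
  ... | yes _ = s≤s (m∸n≤m M (toℕ (inject₁ s)))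
  ... | no  _ = z≤n

  splitter-balance : ∀ i j {m} (pos : Position M m) →
    weightᴾ j (S i m) ≡ weightOf j (splitterNext i pos) + (weightOf j (copyHead i pos) + 0)
  splitter-balance i j end = cong (occurrences (i , j)) suffix-end
  splitter-balance i j (stage s) = begin
    occurrences (i , j) (drop (toℕ (inject₁ s)) stages)
      ≡⟨ cong (occurrences (i , j)) (suffix-stage s) ⟩
    match (i , j) (lookup stages s) + later
      ≡⟨ +-comm (match (i , j) (lookup stages s)) later ⟩
    later + match (i , j) (lookup stages s)
      ≡⟨ cong (later +_) (trans (sym (copy-weight i j s)) (sym (+-identityʳ _))) ⟩
    later + (weightOf j (copyHead i (stage s)) + 0) ∎
    where
    open ≡-Reasoning
    later : ℕ
    later = occurrences (i , j) (drop (toℕ (suc s)) stages)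

  adder-balance : ∀ j j' {m} (pos : Position M m) → weightᴾ j (A j' m) ≡ weightOf j (adderNext j' pos) + 0
  adder-balance j j' (stage s) = sym (+-identityʳ _)
  adder-balance j j' end       = trans (δ-sym j' j) (sym (+-identityʳ _))

  splitter-drop : ∀ i {m} (pos : Position M m) →
    suc (depthOf (splitterNext i pos) + (depthOf (copyHead i pos) + 0)) ≤ depthᴾ (S i m)
  splitter-drop i end       = s≤s z≤n
  splitter-drop i (stage s) = begin
    suc (X + (c + 0))     ≡⟨ cong (λ t → suc (X + t)) (+-identityʳ c) ⟩
    suc (X + c)           ≡⟨ +-suc X c ⟨
    X + suc c             ≤⟨ +-monoʳ-≤ X (s≤s (copy-depth i s)) ⟩
    X + (2 + M)           ≡⟨ +-comm X (2 + M) ⟩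
    suc (suc (remaining (suc s))) * (2 + M) ≡⟨ cong (λ r → suc r * (2 + M)) (remaining-stage s) ⟨
    depthᴾ (S i (inject₁ s)) ∎
    where
    open ≤-Reasoning
    X c : ℕ
    X = depthᴾ (S i (suc s))
    c = depthOf (copyHead i (stage s))

  adder-drop : ∀ j {m} (pos : Position M m) → suc (depthOf (adderNext j pos) + 0) ≤ depthᴾ (A j m)
  adder-drop j end       = s≤s z≤n
  adder-drop j (stage s) = ≤-reflexive (cong suc (trans (+-identityʳ _) (sym (remaining-stage s))))

  certificateᴾ : Certificateᴾ wiring
  certificateᴾ = record
    { deadᴾ           = deadᴾ
    ; weightᴾ         = weightᴾ
    ; depthᴾ          = depthᴾ
    ; weight-balanceᴾ = balance
    ; depth-dropᴾ     = drop-depth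
    ; dead-fedᴾ       = dead-fed
    }
    where
    balance : ∀ j u → deadᴾ u ≡ false → weightᴾ j u ≡ ∑outᴾ wiring (λ e → weightOf j (headᴾ e)) u
    balance j (S i m)  _ = splitter-balance i j (position m)
    balance j (A j' m) _ = adder-balance j j' (position m)
    drop-depth : ∀ u → deadᴾ u ≡ false → suc (∑outᴾ wiring (λ e → depthOf (headᴾ e)) u) ≤ depthᴾ u
    drop-depth (S i m) _ = splitter-drop i (position m)
    drop-depth (A j m) _ = adder-drop j (position m)
    -- Dead nodes are fed only by their own loops.
    dead-fed : ∀ e u p → headᴾ e ≡ nodeᴾ (u , p) → deadᴾ u ≡ true →
               ∃ λ o → e ≡ inj₂ o × deadᴾ (proj₁ o) ≡ true
    dead-fed e (D j m) zero he _ = (D j m , zero) , inEdge-uniqueᴾ _ e he , refl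
    dead-fed e (E j)   zero he _ = (E j , zero) , inEdge-uniqueᴾ _ e he , refl

  certifiedMap-matrix : ∀ x j → Certificateᴾ.certifiedMapᴾ certificateᴾ x j ≡ ∑[ i < k ] (L j i * x i)
  certifiedMap-matrix x j =
    sum-cong-≗ (λ i → trans (cong (x i *_) (occurrences-stages i j)) (*-comm (x i) (L j i)))

computes-resp : ∀ {k ℓ} (N : Network k ℓ) {f g : (Fin k → ℕ) → (Fin ℓ → ℕ)} →
                (∀ x j → f x j ≡ g x j) → Computes N f → Computes N g
computes-resp N f≡g computes x with computes x
... | (c , run , halted , out) , correct =
  (c , run , halted , λ j → trans (out j) (f≡g x j)) ,
  λ c' run' halted' j → trans (correct c' run' halted' j) (f≡g x j)

linear⇒computable : ∀ {k ℓ} {f : (Fin k → ℕ) → (Fin ℓ → ℕ)} → IsLinear f → SAComputable f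
linear⇒computable {f = f} (L , f≡Lx) =
  network wiring , computes-resp (network wiring) agree (Certified.computes (network wiring) certificate′)
  where
  open MatrixNetwork L
  open Presented enumerate kindᴾ
  certificate′ : Certificate (network wiring)
  certificate′ = certificate wiring certificateᴾ
  agree : ∀ x j → Certificate.certifiedMap certificate′ x j ≡ f x j
  agree x j = begin
    Certificate.certifiedMap certificate′ x j           ≡⟨ certifiedMap-encode wiring certificateᴾ x j ⟩
    Certificateᴾ.certifiedMapᴾ certificateᴾ x j          ≡⟨ certifiedMap-matrix x j ⟩
    ∑[ i < _ ] (L j i * x i)                            ≡⟨ ∑≡sum-tabulate (λ i → L j i * x i) ⟩
    Vec.sum (Vec.tabulate λ i → L j i * x i)            ≡⟨ f≡Lx x j ⟨
    f x j                                               ∎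
    where open ≡-Reasoning

lemma2p8 : (k ℓ : ℕ) → 1 ≤ k → 1 ≤ ℓ → (f : (Fin k → ℕ) → (Fin ℓ → ℕ)) →
    (SAComputable f → IsLinear f) × (IsLinear f → SAComputable f)
lemma2p8 k ℓ _ _ f = (λ { (N , computes) → Computed.computable⇒linear N f computes }) , linear⇒computable
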